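{- Let $\Lambda$ be a restorative similarity type and $\mathfrak{M}=\langle W,R,\{P_k\}_{k\in K}\rangle$ a modally saturated Kripke model. Then for all $w,v\in W$: $w$ and $v$ satisfy exactly the same formulas of $\mathcal{L}_{\sim,\Lambda}$ if and only if there is a symmetrical $\Lambda$-simulation $S$ on $\mathfrak{M}$ with $(w,v)\in S$.
   Context: Fix a set $K$. A Kripke model is $\mathfrak{M}=\langle W,R,\{P_k\}_{k\in K}\rangle$ with $W$ nonempty, $R\subseteq W\times W$, each $P_k\subseteq W$; $R[w]=\{v:wRv\}$. Six unary connectives $\smile,\frown,\circ_\smile,\circ_\frown,\bullet_\smile,\bullet_\frown$; a restorative similarity type is any subset $\Lambda$ of these. $\mathcal{L}_{\sim,\Lambda}$ is generated by $\phi::=p_k\mid\top\mid\bot\mid\phi\wedge\phi\mid\phi\vee\phi\mid\sim\phi\mid\star\phi$ ($\star\in\Lambda$). Satisfaction: $w\Vdash p_k$ iff $w\in P_k$; $\top,\bot,\wedge,\vee$ classical; $w\Vdash\sim\phi$ iff $w\not\Vdash\phi$; $w\Vdash\smile\phi$ iff some $v$ with $wRv$ has $v\not\Vdash\phi$; $w\Vdash\frown\phi$ iff every $v$ with $wRv$ has $v\not\Vdash\phi$; $w\Vdash\circ_\smile\phi$ iff $w\not\Vdash\phi$ or every $v$ with $wRv$ has $v\Vdash\phi$; $w\Vdash\circ_\frown\phi$ iff $w\Vdash\phi$ or every $v$ with $wRv$ has $v\not\Vdash\phi$; $w\Vdash\bullet_\smile\phi$ iff $w\Vdash\phi$ and some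 $v$ with $wRv$ has $v\not\Vdash\phi$; $w\Vdash\bullet_\frown\phi$ iff $w\not\Vdash\phi$ and some $v$ with $wRv$ has $v\Vdash\phi$. $\mathcal{L}_{\sim,\Box,\Diamond}$ is generated by $\phi::=p_k\mid\top\mid\bot\mid\phi\wedge\phi\mid\phi\vee\phi\mid\sim\phi\mid\Box\phi\mid\Diamond\phi$, with $w\Vdash\Box\phi$ iff all $v\in R[w]$ satisfy $\phi$ and $w\Vdash\Diamond\phi$ iff some $v\in R[w]$ satisfies $\phi$. $\mathfrak{M}$ is modally saturated if for every $w\in W$ and every $\Delta\subseteq\mathcal{L}_{\sim,\Box,\Diamond}$, if every finite subset of $\Delta$ is satisfied at some world of $R[w]$, then some world of $R[w]$ satisfies all of $\Delta$. A relation $S\subseteq W\times W$ is a $\Lambda$-simulation on $\mathfrak{M}$ if it satisfies (Sim$_k$) for every $k$ and (Sim$\star$) for every $\star\in\Lambda$ (worlds range over $W$): (Sim$_k$) if $(w,v)\in S$ and $w\in P_k$ then $v\in P_k$; (Sim$\smile$) if $(w,v)\in S$ and $wRs$ then there is $t$ with $vRt$ and $(t,s)\in S$; (Sim$\frown$) if $(w,v)\in S$ and $vRt$ then there is $s$ with $wRs$ and $(t,s)\in S$; (Sim$\circ_\smile$) if $(w,v)\in S$ and $vRt$ then either $(v,t)\in S$, or both $(v,w)\in S$ and there is $s$ with $wRs$ and $(s,t)\in S$; (Sim$\circ_\frown$) if $(w,v)\in S$ and $vRt$ then either $(t,v)\in S$, or there is $s$ with $wRs$ and $(t,s)\in S$;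 (Sim$\bullet_\smile$) if $(w,v)\in S$ and $wRs$ then either $(w,s)\in S$, or there is $t$ with $vRt$ and $(t,s)\in S$; (Sim$\bullet_\frown$) if $(w,v)\in S$ and $wRs$ then either $(s,w)\in S$, or both $(v,w)\in S$ and there is $t$ with $vRt$ and $(s,t)\in S$. A symmetrical $\Lambda$-simulation is a $\Lambda$-simulation $S$ such that $(w,v)\in S$ implies $(v,w)\in S$. -}

module Defs where

open import Level using (0ℓ)
open import Data.Product using (Σ; ∃; ∃-syntax; _×_; _,_)
open import Data.Sum using (_⊎_)
open import Data.Unit using (⊤)
open import Data.Empty using (⊥)
open import Data.List using (List)
open import Data.List.Relation.Unary.All using (All)
open import Relation.Nullary using (¬_)
open import Relation.Unary using (Pred; _∈_)

record KripkeModel (K : Set) : Set₁ where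
  field
    W : Set
    inhabited : W
    R : W → W → Set
    P : K → W → Set

data Conn : Set where
  smile frown ∘smile ∘frown •smile •frown : Conn

SimType : Set₁
SimType = Pred Conn 0ℓ

data Form (K : Set) (Λ : SimType) : Set where
  var  : K → Form K Λ
  ⊤f ⊥f : Form K Λ
  _∧f_ _∨f_ : Form K Λ → Form K Λ → Form K Λ
  ∼_ : Form K Λ → Form K Λ
  op : (c : Conn) → c ∈ Λ → Form K Λ → Form K Λ

data MForm (K : Set) : Set where
  var  : K → MForm K
  ⊤f ⊥f : MForm K
  _∧f_ _∨f_ : MForm K → MForm K → MForm K
  ∼_ : MForm K → MForm K
  □_ ◇_ : MForm K → MForm K

module _ {K : Set} (M : KripkeModel K) where
  open KripkeModel M

  conn-sat : Conn → W → (W → Set) → Set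
  conn-sat smile  w A = ∃[ v ] (R w v × ¬ A v)
  conn-sat frown  w A = ∀ v → R w v → ¬ A v
  conn-sat ∘smile w A = ¬ A w ⊎ (∀ v → R w v → A v)
  conn-sat ∘frown w A = A w ⊎ (∀ v → R w v → ¬ A v)
  conn-sat •smile w A = A w × (∃[ v ] (R w v × ¬ A v))
  conn-sat •frown w A = ¬ A w × (∃[ v ] (R w v × A v))

  Sat : {Λ : SimType} → W → Form K Λ → Set
  Sat w (var k) = P k w
  Sat w ⊤f = ⊤
  Sat w ⊥f = ⊥
  Sat w (φ ∧f ψ) = Sat w φ × Sat w ψ
  Sat w (φ ∨f ψ) = Sat w φ ⊎ Sat w ψ
  Sat w (∼ φ) = ¬ Sat w φ
  Sat w (op c _ φ) = conn-sat c w (λ u → Sat u φ)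

  MSat : W → MForm K → Set
  MSat w (var k) = P k w
  MSat w ⊤f = ⊤
  MSat w ⊥f = ⊥
  MSat w (φ ∧f ψ) = MSat w φ × MSat w ψ
  MSat w (φ ∨f ψ) = MSat w φ ⊎ MSat w ψ
  MSat w (∼ φ) = ¬ MSat w φ
  MSat w (□ φ) = ∀ v → R w v → MSat v φ
  MSat w (◇ φ) = ∃[ v ] (R w v × MSat v φ)

  -- Modal saturation; finite subsets of Δ are represented by lists of members of Δ.
  ModallySaturated : Set₁
  ModallySaturated =
    ∀ (w : W) (Δ : MForm K → Set) →
      (∀ (xs : List (MForm K)) → All Δ xs →
         ∃[ v ] (R w v × All (MSat v) xs)) →
      ∃[ v ] (R w v × (∀ φ → Δ φ → MSat v φ))

  SimClause : (W → W → Set) → Conn → Set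
  SimClause S smile  = ∀ w v s → S w v → R w s → ∃[ t ] (R v t × S t s)
  SimClause S frown  = ∀ w v t → S w v → R v t → ∃[ s ] (R w s × S t s)
  SimClause S ∘smile = ∀ w v t → S w v → R v t →
                         S v t ⊎ (S v w × ∃[ s ] (R w s × S s t))
  SimClause S ∘frown = ∀ w v t → S w v → R v t →
                         S t v ⊎ ∃[ s ] (R w s × S t s)
  SimClause S •smile = ∀ w v s → S w v → R w s →
                         S w s ⊎ ∃[ t ] (R v t × S t s)
  SimClause S •frown = ∀ w v s → S w v → R w s →
                         S s w ⊎ (S v w × ∃[ t ] (R v t × S s t))

  IsSimulation : SimType → (W → W → Set) → Set
  IsSimulation Λ S =
    (∀ k w v → S w v → P k w → P k v) ×
    (∀ c → c ∈ Λ → SimClause S c)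

  IsSymSimulation : SimType → (W → W → Set) → Set
  IsSymSimulation Λ S = IsSimulation Λ S × (∀ w v → S w v → S v w)

{-# OPTIONS --safe #-}
-- Soundness: truth of every formula travels along a symmetrical simulation, by induction on
-- the formula; each simulation clause is what its connective needs, with excluded middle
-- settling the truth of the argument at the second world for ∘⌣ and ∘⌢.
-- Completeness: logical equivalence ≈ is itself a symmetrical simulation. Formulas translate
-- into the modal language, so saturation turns "every formula true at t holds at some
-- successor of x" into a successor of x equivalent to t. For ∘⌣, ∘⌢, •⌣ and •⌢, when the
-- two worlds named in the clause's first alternative are not equivalent, a formula χ
-- separating them, combined with ψ under the connective, forces that condition.
module Submission where

open import Defs
open import Axiom.ExcludedMiddle using (ExcludedMiddle)
open import Axiom.DoubleNegationElimination using (em⇒dne)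
open import Level using (0ℓ)
open import Data.Product using (∃-syntax; Σ-syntax; _×_; _,_; map₂)
open import Data.Product.Function.NonDependent.Propositional using (_×-⇔_)
open import Data.Sum using (_⊎_; inj₁; inj₂; [_,_])
open import Data.Sum.Function.Propositional using (_⊎-⇔_)
open import Data.Unit using (tt)
open import Data.Empty using (⊥-elim)
open import Data.List using ([]; _∷_)
open import Data.List.Relation.Unary.All using (All; []; _∷_)
open import Function using (_$_)
open import Function.Bundles using (_⇔_; mk⇔; Equivalence)
open import Function.Construct.Identity using (⇔-id)
import Function.Properties.Equivalence as ⇔
open import Function.Related.TypeIsomorphisms using (¬-cong-⇔)
open import Relation.Nullary using (¬_; yes; no)
open import Relation.Binary.PropositionalEquality using (_≡_; refl; subst)
open import Relation.Unary using (_∈_)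

modalise : ∀ {K} → Conn → MForm K → MForm K
modalise smile  m = ◇ (∼ m)
modalise frown  m = □ (∼ m)
modalise ∘smile m = (∼ m) ∨f (□ m)
modalise ∘frown m = m ∨f (□ (∼ m))
modalise •smile m = m ∧f (◇ (∼ m))
modalise •frown m = (∼ m) ∧f (◇ m)

translate : ∀ {K Λ} → Form K Λ → MForm K
translate (var k)    = var k
translate ⊤f         = ⊤f
translate ⊥f         = ⊥f
translate (φ ∧f ψ)   = translate φ ∧f translate ψ
translate (φ ∨f ψ)   = translate φ ∨f translate ψ
translate (∼ φ)      = ∼ translate φ
translate (op c _ φ) = modalise c (translate φ)

module _ {K : Set} (M : KripkeModel K) where
  open KripkeModel M
  open Equivalence

  conn-sat-map : ∀ c {w} {A B : W → Set} → (∀ u → A u ⇔ B u) →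
                 conn-sat M c w A → conn-sat M c w B
  conn-sat-map smile  A⇔B (u , wu , ¬Au)      = u , wu , λ Bu → ¬Au (from (A⇔B u) Bu)
  conn-sat-map frown  A⇔B none u wu Bu        = none u wu (from (A⇔B u) Bu)
  conn-sat-map ∘smile A⇔B (inj₁ ¬Aw)          = inj₁ λ Bw → ¬Aw (from (A⇔B _) Bw)
  conn-sat-map ∘smile A⇔B (inj₂ all)          = inj₂ λ u wu → to (A⇔B u) (all u wu)
  conn-sat-map ∘frown A⇔B (inj₁ Aw)           = inj₁ (to (A⇔B _) Aw)
  conn-sat-map ∘frown A⇔B (inj₂ none)         = inj₂ λ u wu Bu → none u wu (from (A⇔B u) Bu)
  conn-sat-map •smile A⇔B (Aw , u , wu , ¬Au) =
    to (A⇔B _) Aw , u , wu , λ Bu → ¬Au (from (A⇔B u) Bu)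
  conn-sat-map •frown A⇔B (¬Aw , u , wu , Au) =
    (λ Bw → ¬Aw (from (A⇔B _) Bw)) , u , wu , to (A⇔B u) Au

  conn-sat-cong : ∀ c {w} {A B : W → Set} → (∀ u → A u ⇔ B u) →
                  conn-sat M c w A ⇔ conn-sat M c w B
  conn-sat-cong c A⇔B = mk⇔ (conn-sat-map c A⇔B) (conn-sat-map c (λ u → ⇔.sym (A⇔B u)))

  conn-sat≡MSat-modalise : ∀ c w m → conn-sat M c w (λ u → MSat M u m) ≡ MSat M w (modalise c m)
  conn-sat≡MSat-modalise smile  w m = refl
  conn-sat≡MSat-modalise frown  w m = refl
  conn-sat≡MSat-modalise ∘smile w m = refl
  conn-sat≡MSat-modalise ∘frown w m = refl
  conn-sat≡MSat-modalise •smile w m = refl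
  conn-sat≡MSat-modalise •frown w m = refl

  Sat⇔MSat-translate : ∀ {Λ} (φ : Form K Λ) w → Sat M w φ ⇔ MSat M w (translate φ)
  Sat⇔MSat-translate (var k)    w = ⇔-id _
  Sat⇔MSat-translate ⊤f         w = ⇔-id _
  Sat⇔MSat-translate ⊥f         w = ⇔-id _
  Sat⇔MSat-translate (φ ∧f ψ)   w = Sat⇔MSat-translate φ w ×-⇔ Sat⇔MSat-translate ψ w
  Sat⇔MSat-translate (φ ∨f ψ)   w = Sat⇔MSat-translate φ w ⊎-⇔ Sat⇔MSat-translate ψ w
  Sat⇔MSat-translate (∼ φ)      w = ¬-cong-⇔ (Sat⇔MSat-translate φ w)
  Sat⇔MSat-translate (op c _ φ) w =
    subst (conn-sat M c w (λ u → Sat M u φ) ⇔_) (conn-sat≡MSat-modalise c w (translate φ))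
          (conn-sat-cong c (Sat⇔MSat-translate φ))

module Classical (em : ExcludedMiddle 0ℓ) {K : Set} {Λ : SimType} (M : KripkeModel K) where
  open KripkeModel M

  Formula : Set
  Formula = Form K Λ

  infix 4 _⊨_
  _⊨_ : W → Formula → Set
  x ⊨ φ = Sat M x φ

  private
    dne : {A : Set} → ¬ ¬ A → A
    dne = em⇒dne em

  _⇛_ : W → W → Set
  x ⇛ y = ∀ φ → x ⊨ φ → y ⊨ φ

  _≈_ : W → W → Set
  x ≈ y = x ⇛ y × y ⇛ x

  ≈-sym : ∀ {x y} → x ≈ y → y ≈ x
  ≈-sym (x⇛y , y⇛x) = y⇛x , x⇛y

  ⇛⇒≈ : ∀ {x y} → x ⇛ y → x ≈ y
  ⇛⇒≈ x⇛y = x⇛y , λ φ yφ → dne λ ¬xφ → x⇛y (∼ φ) ¬xφ yφ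

  ≈-or-distinguished : ∀ x y → x ≈ y ⊎ Σ[ χ ∈ Formula ] (x ⊨ χ × ¬ y ⊨ χ)
  ≈-or-distinguished x y with em {Σ[ χ ∈ Formula ] (x ⊨ χ × ¬ y ⊨ χ)}
  ... | yes distinguished = inj₂ distinguished
  ... | no ¬distinguished = inj₁ (⇛⇒≈ λ φ xφ → dne λ ¬yφ → ¬distinguished (φ , xφ , ¬yφ))

  Preserved : (W → W → Set) → (W → Set) → Set
  Preserved S A = ∀ {x y} → S x y → A x → A y

  conn-sat-preserved : ∀ {S A} c → (∀ x y → S x y → S y x) → SimClause M S c →
                       Preserved S A → Preserved S (λ x → conn-sat M c x A)
  conn-sat-preserved smile _ clause pres {x} {y} xSy (u , xRu , ¬Au)
    with clause x y u xSy xRu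
  ... | t , yRt , tSu = t , yRt , λ At → ¬Au (pres tSu At)
  conn-sat-preserved frown _ clause pres {x} {y} xSy none t yRt At
    with clause x y t xSy yRt
  ... | u , xRu , tSu = none u xRu (pres tSu At)
  conn-sat-preserved ∘smile sym _ pres {x} {y} xSy (inj₁ ¬Ax) =
    inj₁ λ Ay → ¬Ax (pres (sym x y xSy) Ay)
  conn-sat-preserved {A = A} ∘smile _ clause pres {x} {y} xSy (inj₂ all) with em {A y}
  ... | no ¬Ay = inj₁ ¬Ay
  ... | yes Ay = inj₂ λ t yRt →
    [ (λ ySt → pres ySt Ay) , (λ (_ , u , xRu , uSt) → pres uSt (all u xRu)) ]
      (clause x y t xSy yRt)
  conn-sat-preserved ∘frown _ _ pres xSy (inj₁ Ax) = inj₁ (pres xSy Ax)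
  conn-sat-preserved {A = A} ∘frown _ clause pres {x} {y} xSy (inj₂ none) with em {A y}
  ... | yes Ay = inj₁ Ay
  ... | no ¬Ay = inj₂ λ t yRt At →
    [ (λ tSy → ¬Ay (pres tSy At)) , (λ (u , xRu , tSu) → none u xRu (pres tSu At)) ]
      (clause x y t xSy yRt)
  conn-sat-preserved •smile _ clause pres {x} {y} xSy (Ax , u , xRu , ¬Au)
    with clause x y u xSy xRu
  ... | inj₁ xSu = ⊥-elim (¬Au (pres xSu Ax))
  ... | inj₂ (t , yRt , tSu) = pres xSy Ax , t , yRt , λ At → ¬Au (pres tSu At)
  conn-sat-preserved •frown sym clause pres {x} {y} xSy (¬Ax , u , xRu , Au)
    with clause x y u xSy xRu
  ... | inj₁ uSx = ⊥-elim (¬Ax (pres uSx Au))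
  ... | inj₂ (_ , t , yRt , uSt) = (λ Ay → ¬Ax (pres (sym x y xSy) Ay)) , t , yRt , pres uSt Au

  Sat-preserved : ∀ {S} → IsSymSimulation M Λ S → ∀ φ → Preserved S (_⊨ φ)
  Sat-preserved ((atoms , _) , _) (var k) {x} {y} xSy = atoms k x y xSy
  Sat-preserved sim ⊤f       xSy _         = tt
  Sat-preserved sim ⊥f       xSy ()
  Sat-preserved sim (φ ∧f ψ) xSy (xφ , xψ) = Sat-preserved sim φ xSy xφ , Sat-preserved sim ψ xSy xψ
  Sat-preserved sim (φ ∨f ψ) xSy (inj₁ xφ) = inj₁ (Sat-preserved sim φ xSy xφ)
  Sat-preserved sim (φ ∨f ψ) xSy (inj₂ xψ) = inj₂ (Sat-preserved sim ψ xSy xψ)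
  Sat-preserved sim@(_ , sym) (∼ φ) {x} {y} xSy ¬xφ yφ = ¬xφ (Sat-preserved sim φ (sym x y xSy) yφ)
  Sat-preserved sim@((_ , clauses) , sym) (op c c∈Λ φ) =
    conn-sat-preserved c sym (clauses c c∈Λ) (Sat-preserved sim φ)

  symSimulation⇒≈ : ∀ {S x y} → IsSymSimulation M Λ S → S x y → x ≈ y
  symSimulation⇒≈ {x = x} {y} sim@(_ , sym) xSy =
    (λ φ → Sat-preserved sim φ xSy) , (λ φ → Sat-preserved sim φ (sym x y xSy))

  _⇝_ : W → W → Set
  x ⇝ t = ∀ ψ → t ⊨ ψ → ∃[ s ] (R x s × s ⊨ ψ)

  ⇝-by-contradiction : ∀ {x t} → (∀ ψ → t ⊨ ψ → ¬ (∀ s → R x s → ¬ s ⊨ ψ)) → x ⇝ t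
  ⇝-by-contradiction refuted ψ tψ = dne λ ¬∃ → refuted ψ tψ λ s xRs sψ → ¬∃ (s , xRs , sψ)

  TranslatedTheory : W → MForm K → Set
  TranslatedTheory t m = Σ[ φ ∈ Formula ] (translate φ ≡ m × t ⊨ φ)

  TranslatedTheory-finite-conjunction :
    ∀ {t} ms → All (TranslatedTheory t) ms →
    Σ[ ψ ∈ Formula ] (t ⊨ ψ × ∀ s → s ⊨ ψ → All (MSat M s) ms)
  TranslatedTheory-finite-conjunction [] [] = ⊤f , tt , λ _ _ → []
  TranslatedTheory-finite-conjunction (_ ∷ ms) ((φ , refl , tφ) ∷ ms∈Th)
    with TranslatedTheory-finite-conjunction ms ms∈Th
  ... | ψ , tψ , ψ⇒ms =
    φ ∧f ψ , (tφ , tψ) , λ s (sφ , sψ) → Equivalence.to (Sat⇔MSat-translate M φ s) sφ ∷ ψ⇒ms s sψ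

  module _ (saturated : ModallySaturated M) where

    ⇝⇒≈-successor : ∀ {x t} → x ⇝ t → ∃[ s ] (R x s × t ≈ s)
    ⇝⇒≈-successor {x} {t} x⇝t with saturated x (TranslatedTheory t) finitely-satisfiable
      where
      finitely-satisfiable : ∀ ms → All (TranslatedTheory t) ms → ∃[ s ] (R x s × All (MSat M s) ms)
      finitely-satisfiable ms ms∈Th =
        let ψ , tψ , ψ⇒ms = TranslatedTheory-finite-conjunction ms ms∈Th
            s , xRs , sψ = x⇝t ψ tψ
        in s , xRs , ψ⇒ms s sψ
    ... | s , xRs , s⊨Th =
      s , xRs , ⇛⇒≈ λ φ tφ → Equivalence.from (Sat⇔MSat-translate M φ s) (s⊨Th _ (φ , refl , tφ))

    ≈-smile : smile ∈ Λ → SimClause M _≈_ smile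
    ≈-smile ∈Λ w v s (w⇛v , _) wRs = map₂ (map₂ ≈-sym) (⇝⇒≈-successor v⇝s)
      where
      v⇝s : v ⇝ s
      v⇝s = ⇝-by-contradiction λ ψ sψ ¬ψ-below-v →
        let t , vRt , ¬¬tψ = w⇛v (op smile ∈Λ (∼ ψ)) (s , wRs , (_$ sψ))
        in ¬¬tψ (¬ψ-below-v t vRt)

    ≈-frown : frown ∈ Λ → SimClause M _≈_ frown
    ≈-frown ∈Λ w v t (w⇛v , _) vRt = ⇝⇒≈-successor w⇝t
      where
      w⇝t : w ⇝ t
      w⇝t = ⇝-by-contradiction λ ψ tψ ¬ψ-below-w → w⇛v (op frown ∈Λ ψ) ¬ψ-below-w t vRt tψ

    ≈-∘smile : ∘smile ∈ Λ → SimClause M _≈_ ∘smile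
    ≈-∘smile ∈Λ w v t w≈v@(w⇛v , _) vRt with ≈-or-distinguished v t
    ... | inj₁ v≈t = inj₁ v≈t
    ... | inj₂ (χ , vχ , ¬tχ) = inj₂ (≈-sym w≈v , map₂ (map₂ ≈-sym) (⇝⇒≈-successor w⇝t))
      where
      w⇝t : w ⇝ t
      w⇝t = ⇝-by-contradiction λ ψ tψ ¬ψ-below-w →
        [ (λ ¬vθ → ¬vθ (inj₁ vχ)) , (λ θ-below-v → [ ¬tχ , (_$ tψ) ] (θ-below-v t vRt)) ]
          (w⇛v (op ∘smile ∈Λ (χ ∨f (∼ ψ))) (inj₂ λ s wRs → inj₂ (¬ψ-below-w s wRs)))

    ≈-∘frown : ∘frown ∈ Λ → SimClause M _≈_ ∘frown
    ≈-∘frown ∈Λ w v t (w⇛v , _) vRt with ≈-or-distinguished t v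
    ... | inj₁ t≈v = inj₁ t≈v
    ... | inj₂ (χ , tχ , ¬vχ) = inj₂ (⇝⇒≈-successor w⇝t)
      where
      w⇝t : w ⇝ t
      w⇝t = ⇝-by-contradiction λ ψ tψ ¬ψ-below-w →
        [ (λ (vχ , _) → ¬vχ vχ) , (λ ¬θ-below-v → ¬θ-below-v t vRt (tχ , tψ)) ]
          (w⇛v (op ∘frown ∈Λ (χ ∧f ψ)) (inj₂ λ s wRs (_ , sψ) → ¬ψ-below-w s wRs sψ))

    ≈-•smile : •smile ∈ Λ → SimClause M _≈_ •smile
    ≈-•smile ∈Λ w v s (w⇛v , _) wRs with ≈-or-distinguished w s
    ... | inj₁ w≈s = inj₁ w≈s
    ... | inj₂ (χ , wχ , ¬sχ) = inj₂ (map₂ (map₂ ≈-sym) (⇝⇒≈-successor v⇝s))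
      where
      v⇝s : v ⇝ s
      v⇝s = ⇝-by-contradiction λ ψ sψ ¬ψ-below-v →
        let _ , t , vRt , ¬tθ =
              w⇛v (op •smile ∈Λ (χ ∨f (∼ ψ))) (inj₁ wχ , s , wRs , [ ¬sχ , (_$ sψ) ])
        in ¬tθ (inj₂ (¬ψ-below-v t vRt))

    ≈-•frown : •frown ∈ Λ → SimClause M _≈_ •frown
    ≈-•frown ∈Λ w v s w≈v@(w⇛v , _) wRs with ≈-or-distinguished s w
    ... | inj₁ s≈w = inj₁ s≈w
    ... | inj₂ (χ , sχ , ¬wχ) = inj₂ (≈-sym w≈v , ⇝⇒≈-successor v⇝s)
      where
      v⇝s : v ⇝ s
      v⇝s ψ sψ =
        let _ , t , vRt , (_ , tψ) =
              w⇛v (op •frown ∈Λ (χ ∧f ψ)) ((λ (wχ , _) → ¬wχ wχ) , s , wRs , (sχ , sψ))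
        in t , vRt , tψ

    ≈-isSymSimulation : IsSymSimulation M Λ _≈_
    ≈-isSymSimulation = ((λ k w v (w⇛v , _) → w⇛v (var k)) , clause) , λ _ _ → ≈-sym
      where
      clause : ∀ c → c ∈ Λ → SimClause M _≈_ c
      clause smile  = ≈-smile
      clause frown  = ≈-frown
      clause ∘smile = ≈-∘smile
      clause ∘frown = ≈-∘frown
      clause •smile = ≈-•smile
      clause •frown = ≈-•frown

theorem8p5 : (∀ {ℓ} → ExcludedMiddle ℓ) →
    (K : Set) (Λ : SimType) (M : KripkeModel K) →
    ModallySaturated M →
    (w v : KripkeModel.W M) →
    ((∀ (φ : Form K Λ) → Sat M w φ → Sat M v φ) × (∀ (φ : Form K Λ) → Sat M v φ → Sat M w φ)
      → ∃[ S ] (IsSymSimulation M Λ S × S w v))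
    × (∃[ S ] (IsSymSimulation M Λ S × S w v)
      → (∀ (φ : Form K Λ) → Sat M w φ → Sat M v φ) × (∀ (φ : Form K Λ) → Sat M v φ → Sat M w φ))
theorem8p5 em K Λ M saturated w v =
  (λ w≈v → _≈_ , ≈-isSymSimulation saturated , w≈v) ,
  (λ (S , sim , wSv) → symSimulation⇒≈ sim wSv)
  where open Classical em {K} {Λ} M
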